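{- Let $G=G(A,B)$ be a copy of $K_{n,n}$ with parts $A,B$ and an edge-coloring $c\colon E(G)\to C(G)$, where $C(G)$ is the set of colors used, and let $r\ge 2$ be an integer. Let $G^r$ be the bipartite graph with parts $A^r$ and $B^r$ in which $(a_1,\ldots,a_r)\in A^r$ and $(b_1,\ldots,b_r)\in B^r$ are adjacent if and only if $c(a_1b_1)=c(a_2b_2)=\cdots=c(a_rb_r)$. Then $$|C(G)|\ge \left(\frac{n^{2r}}{|E(G^r)|}\right)^{\frac{1}{r-1}}.$$
   Context: Edge-colorings are not required to be proper. $A^r$ denotes the set of ordered $r$-tuples of elements of $A$. -}

module Defs where

open import Data.Nat using (ℕ; zero; suc)
open import Data.Fin using (Fin)
open import Data.Fin.Properties using (all?; _≟_)
open import Data.Vec using (Vec; []; _∷_; lookup)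
open import Data.List using (List; [_]; map; concatMap; allFin; filter; length; cartesianProduct)
open import Data.Product using (_×_; _,_)
open import Relation.Binary.PropositionalEquality using (_≡_)
open import Relation.Nullary using (Dec)

tuples : (n r : ℕ) → List (Vec (Fin n) r)
tuples n zero    = [ [] ]
tuples n (suc r) = concatMap (λ i → map (i ∷_) (tuples n r)) (allFin n)

Adjacentʳ : ∀ {n k r} → (Fin n → Fin n → Fin k) →
            Vec (Fin n) r × Vec (Fin n) r → Set
Adjacentʳ c (as , bs) =
  ∀ i j → c (lookup as i) (lookup bs i) ≡ c (lookup as j) (lookup bs j)

adjacentʳ? : ∀ {n k r} (c : Fin n → Fin n → Fin k) →
             (p : Vec (Fin n) r × Vec (Fin n) r) → Dec (Adjacentʳ c p)
adjacentʳ? c (as , bs) =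
  all? (λ i → all? (λ j → c (lookup as i) (lookup bs i) ≟ c (lookup as j) (lookup bs j)))

edgesʳ : ∀ {n k} (r : ℕ) → (Fin n → Fin n → Fin k) → ℕ
edgesʳ {n} r c =
  length (filter (adjacentʳ? c) (cartesianProduct (tuples n r) (tuples n r)))

-- Group the n² edges of G by colour, and let N γ be the number of edges of
-- colour γ, so that Σ_γ N γ = n². An edge of G^r is a pair of r-tuples whose r
-- coordinate pairs all carry one common colour γ, hence |E(G^r)| = Σ_γ (N γ)^r.
-- The power mean inequality (Σ_γ N γ)^r ≤ k^(r-1) Σ_γ (N γ)^r, which follows by
-- induction from Chebyshev's sum inequality, then gives n^(2r) ≤ k^(r-1) |E(G^r)|.
module Submission where

open import Data.Fin using (Fin; zero; suc)
import Data.Fin.Properties as Fin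
open import Data.List
  using (List; []; _∷_; map; _++_; concatMap; length; filter; cartesianProduct; tabulate; allFin)
open import Data.List.Properties using (length-tabulate; map-tabulate)
open import Data.Nat using (ℕ; zero; suc; _+_; _*_; _^_; _∸_; _≤_; z≤n; s≤s)
open import Data.Nat.ListAction using (sum)
open import Data.Nat.Properties
open import Data.Nat.Solver using (module +-*-Solver)
open import Data.Product using (_×_; _,_; proj₁; proj₂)
open import Data.Sum using (inj₁; inj₂)
open import Data.Vec using (Vec; []; _∷_; lookup)
open import Function.Definitions using (Surjective)
open import Relation.Binary.PropositionalEquality
open import Relation.Nullary using (Dec; yes; no; ¬_; contradiction)
open import Relation.Unary using (Pred; Decidable)

open import Defs

open +-*-Solver

indicator : ∀ {p} {P : Set p} → Dec P → ℕ
indicator (yes _) = 1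
indicator (no _)  = 0

module _ {a} {A : Set a} where

  ∑ : List A → (A → ℕ) → ℕ
  ∑ xs f = sum (map f xs)

  infixr 5 ∑
  syntax ∑ xs (λ x → e) = ∑[ x ∈ xs ] e

  ∑-cong : ∀ (xs : List A) {f g : A → ℕ} → (∀ x → f x ≡ g x) → ∑ xs f ≡ ∑ xs g
  ∑-cong []       f≗g = refl
  ∑-cong (x ∷ xs) f≗g = cong₂ _+_ (f≗g x) (∑-cong xs f≗g)

  ∑-mono-≤ : ∀ (xs : List A) {f g : A → ℕ} → (∀ x → f x ≤ g x) → ∑ xs f ≤ ∑ xs g
  ∑-mono-≤ []       f≤g = z≤n
  ∑-mono-≤ (x ∷ xs) f≤g = +-mono-≤ (f≤g x) (∑-mono-≤ xs f≤g)

  ∑-zero : ∀ (xs : List A) → ∑[ _ ∈ xs ] 0 ≡ 0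
  ∑-zero []       = refl
  ∑-zero (x ∷ xs) = ∑-zero xs

  ∑-const : ∀ (xs : List A) m → ∑[ _ ∈ xs ] m ≡ length xs * m
  ∑-const []       m = refl
  ∑-const (x ∷ xs) m = cong (m +_) (∑-const xs m)

  ∑-distrib-+ : ∀ (xs : List A) (f g : A → ℕ) → ∑[ x ∈ xs ] (f x + g x) ≡ ∑ xs f + ∑ xs g
  ∑-distrib-+ []       f g = refl
  ∑-distrib-+ (x ∷ xs) f g rewrite ∑-distrib-+ xs f g =
    solve 4 (λ a b c d → (a :+ b) :+ (c :+ d) := (a :+ c) :+ (b :+ d)) refl
      (f x) (g x) (∑ xs f) (∑ xs g)

  *-distribˡ-∑ : ∀ m (xs : List A) (f : A → ℕ) → m * ∑ xs f ≡ ∑[ x ∈ xs ] m * f x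
  *-distribˡ-∑ m []       f = *-zeroʳ m
  *-distribˡ-∑ m (x ∷ xs) f = trans (*-distribˡ-+ m (f x) (∑ xs f)) (cong (m * f x +_) (*-distribˡ-∑ m xs f))

  *-distribʳ-∑ : ∀ m (xs : List A) (f : A → ℕ) → ∑ xs f * m ≡ ∑[ x ∈ xs ] f x * m
  *-distribʳ-∑ m []       f = refl
  *-distribʳ-∑ m (x ∷ xs) f = trans (*-distribʳ-+ m (f x) (∑ xs f)) (cong (f x * m +_) (*-distribʳ-∑ m xs f))

  ∑-++ : ∀ (xs ys : List A) f → ∑ (xs ++ ys) f ≡ ∑ xs f + ∑ ys f
  ∑-++ []       ys f = refl
  ∑-++ (x ∷ xs) ys f = trans (cong (f x +_) (∑-++ xs ys f)) (sym (+-assoc (f x) (∑ xs f) (∑ ys f)))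

  length-filter≡∑ : ∀ {p} {P : Pred A p} (P? : Decidable P) (xs : List A) →
                    length (filter P? xs) ≡ ∑[ x ∈ xs ] indicator (P? x)
  length-filter≡∑ P? []       = refl
  length-filter≡∑ P? (x ∷ xs) with P? x
  ... | yes _ = cong suc (length-filter≡∑ P? xs)
  ... | no  _ = length-filter≡∑ P? xs

∑-map : ∀ {a b} {A : Set a} {B : Set b} (h : A → B) (xs : List A) (f : B → ℕ) →
        ∑ (map h xs) f ≡ ∑[ x ∈ xs ] f (h x)
∑-map h []       f = refl
∑-map h (x ∷ xs) f = cong (f (h x) +_) (∑-map h xs f)

module _ {a b} {A : Set a} {B : Set b} where

  ∑-concatMap : ∀ (g : A → List B) (xs : List A) (f : B → ℕ) →
                ∑ (concatMap g xs) f ≡ ∑[ x ∈ xs ] ∑ (g x) f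
  ∑-concatMap g []       f = refl
  ∑-concatMap g (x ∷ xs) f =
    trans (∑-++ (g x) (concatMap g xs) f) (cong (∑ (g x) f +_) (∑-concatMap g xs f))

  ∑-cartesianProduct : ∀ (xs : List A) (ys : List B) (f : A × B → ℕ) →
                       ∑ (cartesianProduct xs ys) f ≡ ∑[ x ∈ xs ] ∑[ y ∈ ys ] f (x , y)
  ∑-cartesianProduct []       ys f = refl
  ∑-cartesianProduct (x ∷ xs) ys f =
    trans (∑-++ (map (x ,_) ys) (cartesianProduct xs ys) f)
          (cong₂ _+_ (∑-map (x ,_) ys f) (∑-cartesianProduct xs ys f))

  ∑-comm : ∀ (xs : List A) (ys : List B) (f : A → B → ℕ) →
           ∑[ x ∈ xs ] ∑[ y ∈ ys ] f x y ≡ ∑[ y ∈ ys ] ∑[ x ∈ xs ] f x y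
  ∑-comm []       ys f = sym (∑-zero ys)
  ∑-comm (x ∷ xs) ys f =
    trans (cong (∑ ys (f x) +_) (∑-comm xs ys f))
          (sym (∑-distrib-+ ys (f x) (λ y → ∑[ x′ ∈ xs ] f x′ y)))

∑∑∑-comm : ∀ {a b c} {A : Set a} {B : Set b} {C : Set c}
           (xs : List A) (ys : List B) (zs : List C) (f : A → B → C → ℕ) →
           ∑[ x ∈ xs ] ∑[ y ∈ ys ] ∑[ z ∈ zs ] f x y z ≡ ∑[ z ∈ zs ] ∑[ x ∈ xs ] ∑[ y ∈ ys ] f x y z
∑∑∑-comm xs ys zs f =
  trans (∑-cong xs (λ x → ∑-comm ys zs (f x))) (∑-comm xs zs (λ x z → ∑[ y ∈ ys ] f x y z))

rearrangement : ∀ {x y u v} → x ≤ y → u ≤ v → x * v + y * u ≤ x * u + y * v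
rearrangement {x} {y} {u} {v} x≤y u≤v =
  subst₂ (λ y v → x * v + y * u ≤ x * u + y * v) (m+[n∸m]≡n x≤y) (m+[n∸m]≡n u≤v)
    (shifted (y ∸ x) (v ∸ u))
  where
    shifted : ∀ d e → x * (u + e) + (x + d) * u ≤ x * u + (x + d) * (u + e)
    shifted d e = begin
        x * (u + e) + (x + d) * u          ≤⟨ m≤m+n _ (d * e) ⟩
        x * (u + e) + (x + d) * u + d * e  ≡⟨ gap x d u e ⟩
        x * u + (x + d) * (u + e)          ∎
      where
        open ≤-Reasoning
        gap : ∀ x d u e → x * (u + e) + (x + d) * u + d * e ≡ x * u + (x + d) * (u + e)
        gap = solve 4 (λ x d u e → x :* (u :+ e) :+ (x :+ d) :* u :+ d :* e
                                 := x :* u :+ (x :+ d) :* (u :+ e)) refl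

^-rearrangement : ∀ x y p → x * y ^ p + y * x ^ p ≤ x ^ suc p + y ^ suc p
^-rearrangement x y p with ≤-total x y
... | inj₁ x≤y = rearrangement x≤y (^-monoˡ-≤ p x≤y)
... | inj₂ y≤x = subst₂ _≤_ (+-comm (y * x ^ p) (x * y ^ p)) (+-comm (y ^ suc p) (x ^ suc p))
                   (rearrangement y≤x (^-monoˡ-≤ p y≤x))

module _ {a} {A : Set a} where

  chebyshev : ∀ (xs : List A) (f : A → ℕ) p →
              ∑ xs f * (∑[ x ∈ xs ] f x ^ p) ≤ length xs * (∑[ x ∈ xs ] f x ^ suc p)
  chebyshev []       f p = z≤n
  chebyshev (x ∷ xs) f p =
    subst₂ _≤_ (sym split-lhs) (sym split-rhs)
      (+-mono-≤ (+-monoʳ-≤ (f x ^ suc p) cross-terms) (chebyshev xs f p))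
    where
      S = ∑ xs f
      T = ∑[ y ∈ xs ] f y ^ p
      U = ∑[ y ∈ xs ] f y ^ suc p
      k = length xs

      cross-terms : f x * T + S * f x ^ p ≤ k * f x ^ suc p + U
      cross-terms = begin
          f x * T + S * f x ^ p
            ≡⟨ cong₂ _+_ (*-distribˡ-∑ (f x) xs _) (*-distribʳ-∑ (f x ^ p) xs f) ⟩
          (∑[ y ∈ xs ] f x * f y ^ p) + (∑[ y ∈ xs ] f y * f x ^ p)
            ≡⟨ sym (∑-distrib-+ xs _ _) ⟩
          ∑[ y ∈ xs ] (f x * f y ^ p + f y * f x ^ p)
            ≤⟨ ∑-mono-≤ xs (λ y → ^-rearrangement (f x) (f y) p) ⟩
          ∑[ y ∈ xs ] (f x ^ suc p + f y ^ suc p)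
            ≡⟨ ∑-distrib-+ xs _ _ ⟩
          (∑[ _ ∈ xs ] f x ^ suc p) + U
            ≡⟨ cong (_+ U) (∑-const xs _) ⟩
          k * f x ^ suc p + U ∎
        where open ≤-Reasoning

      split-lhs : (f x + S) * (f x ^ p + T) ≡ f x ^ suc p + (f x * T + S * f x ^ p) + S * T
      split-lhs = solve 4 (λ b S P T → (b :+ S) :* (P :+ T) := b :* P :+ (b :* T :+ S :* P) :+ S :* T)
                    refl (f x) S (f x ^ p) T

      split-rhs : suc k * (f x ^ suc p + U) ≡ f x ^ suc p + (k * f x ^ suc p + U) + k * U
      split-rhs = solve 3 (λ k P U → (con 1 :+ k) :* (P :+ U) := P :+ (k :* P :+ U) :+ k :* U)
                    refl k (f x ^ suc p) U

  power-mean : ∀ (xs : List A) (f : A → ℕ) r →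
               ∑ xs f ^ suc r ≤ length xs ^ r * (∑[ x ∈ xs ] f x ^ suc r)
  power-mean xs f zero = ≤-reflexive (begin
      ∑ xs f * 1                      ≡⟨ *-identityʳ _ ⟩
      ∑ xs f                          ≡⟨ ∑-cong xs (λ x → sym (*-identityʳ (f x))) ⟩
      ∑[ x ∈ xs ] f x ^ 1             ≡⟨ sym (*-identityˡ _) ⟩
      1 * (∑[ x ∈ xs ] f x ^ 1)       ∎)
    where open ≡-Reasoning
  power-mean xs f (suc r) = begin
      ∑ xs f * ∑ xs f ^ suc r
        ≤⟨ *-monoʳ-≤ (∑ xs f) (power-mean xs f r) ⟩
      ∑ xs f * (L ^ r * (∑[ x ∈ xs ] f x ^ suc r))
        ≡⟨ x*[y*z]≡y*[x*z] (∑ xs f) (L ^ r) _ ⟩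
      L ^ r * (∑ xs f * (∑[ x ∈ xs ] f x ^ suc r))
        ≤⟨ *-monoʳ-≤ (L ^ r) (chebyshev xs f (suc r)) ⟩
      L ^ r * (L * (∑[ x ∈ xs ] f x ^ suc (suc r)))
        ≡⟨ x*[y*z]≡y*[x*z] (L ^ r) L _ ⟩
      L * (L ^ r * (∑[ x ∈ xs ] f x ^ suc (suc r)))
        ≡⟨ sym (*-assoc L (L ^ r) _) ⟩
      L ^ suc r * (∑[ x ∈ xs ] f x ^ suc (suc r)) ∎
    where
      L = length xs
      open ≤-Reasoning
      x*[y*z]≡y*[x*z] : ∀ x y z → x * (y * z) ≡ y * (x * z)
      x*[y*z]≡y*[x*z] = solve 3 (λ x y z → x :* (y :* z) := y :* (x :* z)) refl

δ : ∀ {k} → Fin k → Fin k → ℕ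
δ zero    zero    = 1
δ zero    (suc _) = 0
δ (suc _) zero    = 0
δ (suc x) (suc y) = δ x y

δ-refl : ∀ {k} (x : Fin k) → δ x x ≡ 1
δ-refl zero    = refl
δ-refl (suc x) = δ-refl x

δ-≢ : ∀ {k} {x y : Fin k} → x ≢ y → δ x y ≡ 0
δ-≢ {x = zero}  {zero}  x≢y = contradiction refl x≢y
δ-≢ {x = zero}  {suc _} x≢y = refl
δ-≢ {x = suc _} {zero}  x≢y = refl
δ-≢ {x = suc x} {suc y} x≢y = δ-≢ (λ x≡y → x≢y (cong suc x≡y))

length-allFin : ∀ k → length (allFin k) ≡ k
length-allFin k = length-tabulate (λ i → i)

∑-allFin-suc : ∀ k (f : Fin (suc k) → ℕ) → ∑ (allFin (suc k)) f ≡ f zero + (∑[ y ∈ allFin k ] f (suc y))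
∑-allFin-suc k f = cong (f zero +_) (begin
    ∑ (tabulate suc) f             ≡⟨ cong (λ ys → ∑ ys f) (sym (map-tabulate (λ i → i) suc)) ⟩
    ∑ (map suc (allFin k)) f       ≡⟨ ∑-map suc (allFin k) f ⟩
    ∑[ y ∈ allFin k ] f (suc y)    ∎)
  where open ≡-Reasoning

∑-δ : ∀ {k} (x : Fin k) (f : Fin k → ℕ) → ∑[ y ∈ allFin k ] δ x y * f y ≡ f x
∑-δ {suc k} zero    f = begin
    ∑[ y ∈ allFin (suc k) ] δ zero y * f y    ≡⟨ ∑-allFin-suc k (λ y → δ zero y * f y) ⟩
    f zero + 0 + (∑[ _ ∈ allFin k ] 0)       ≡⟨ cong (f zero + 0 +_) (∑-zero (allFin k)) ⟩
    f zero + 0 + 0                            ≡⟨ trans (+-identityʳ _) (+-identityʳ _) ⟩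
    f zero                                    ∎
  where open ≡-Reasoning
∑-δ {suc k} (suc x) f = trans (∑-allFin-suc k (λ y → δ (suc x) y * f y)) (∑-δ x (λ y → f (suc y)))

∑-tuples-suc : ∀ n r (f : Vec (Fin n) (suc r) → ℕ) →
               ∑ (tuples n (suc r)) f ≡ ∑[ a ∈ allFin n ] ∑[ as ∈ tuples n r ] f (a ∷ as)
∑-tuples-suc n r f =
  trans (∑-concatMap (λ a → map (a ∷_) (tuples n r)) (allFin n) f)
        (∑-cong (allFin n) (λ a → ∑-map (a ∷_) (tuples n r) f))

∑∑-tuples-suc : ∀ n r (g : Vec (Fin n) (suc r) → Vec (Fin n) (suc r) → ℕ) →
  ∑[ as ∈ tuples n (suc r) ] ∑[ bs ∈ tuples n (suc r) ] g as bs ≡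
  ∑[ a ∈ allFin n ] ∑[ b ∈ allFin n ] ∑[ as ∈ tuples n r ] ∑[ bs ∈ tuples n r ] g (a ∷ as) (b ∷ bs)
∑∑-tuples-suc n r g =
  trans (∑-tuples-suc n r _)
        (∑-cong (allFin n) (λ a →
          trans (∑-cong (tuples n r) (λ as → ∑-tuples-suc n r (g (a ∷ as))))
                (∑-comm (tuples n r) (allFin n) (λ as b → ∑[ bs ∈ tuples n r ] g (a ∷ as) (b ∷ bs)))))

module Colouring {n k : ℕ} (c : Fin n → Fin n → Fin k) where

  colourClassSize : Fin k → ℕ
  colourClassSize γ = ∑[ a ∈ allFin n ] ∑[ b ∈ allFin n ] δ (c a b) γ

  allOfColour : ∀ {r} → Fin k → Vec (Fin n) r → Vec (Fin n) r → ℕ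
  allOfColour γ []       []       = 1
  allOfColour γ (a ∷ as) (b ∷ bs) = δ (c a b) γ * allOfColour γ as bs

  allOfColour≡1 : ∀ {r} γ (as bs : Vec (Fin n) r) →
                  (∀ i → c (lookup as i) (lookup bs i) ≡ γ) → allOfColour γ as bs ≡ 1
  allOfColour≡1 γ []       []       _ = refl
  allOfColour≡1 γ (a ∷ as) (b ∷ bs) coloured
    rewrite coloured zero | δ-refl γ | allOfColour≡1 γ as bs (λ i → coloured (suc i)) = refl

  allOfColour≡0 : ∀ {r} γ (as bs : Vec (Fin n) r) →
                  ¬ (∀ i → c (lookup as i) (lookup bs i) ≡ γ) → allOfColour γ as bs ≡ 0
  allOfColour≡0 γ []       []       ¬coloured = contradiction (λ ()) ¬coloured
  allOfColour≡0 γ (a ∷ as) (b ∷ bs) ¬coloured with c a b Fin.≟ γ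
  ... | no  ab≢γ rewrite δ-≢ ab≢γ = refl
  ... | yes ab≡γ rewrite ab≡γ | δ-refl γ =
    trans (+-identityʳ _) (allOfColour≡0 γ as bs (λ coloured → ¬coloured λ where
      zero    → ab≡γ
      (suc i) → coloured i))

  indicator-adjacentʳ : ∀ {r} a b (as bs : Vec (Fin n) r) →
                        indicator (adjacentʳ? c (a ∷ as , b ∷ bs)) ≡ allOfColour (c a b) as bs
  indicator-adjacentʳ a b as bs with adjacentʳ? c (a ∷ as , b ∷ bs)
  ... | yes adjacent = sym (allOfColour≡1 (c a b) as bs (λ i → adjacent (suc i) zero))
  ... | no ¬adjacent = sym (allOfColour≡0 (c a b) as bs (λ coloured →
                         ¬adjacent (λ i j → trans (colour-of coloured i) (sym (colour-of coloured j)))))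
    where
      colour-of : (∀ i → c (lookup as i) (lookup bs i) ≡ c a b) →
                  ∀ i → c (lookup (a ∷ as) i) (lookup (b ∷ bs) i) ≡ c a b
      colour-of coloured zero    = refl
      colour-of coloured (suc i) = coloured i

  indicator-adjacentʳ≡∑ : ∀ {r} (as bs : Vec (Fin n) (suc r)) →
                          indicator (adjacentʳ? c (as , bs)) ≡ ∑[ γ ∈ allFin k ] allOfColour γ as bs
  indicator-adjacentʳ≡∑ (a ∷ as) (b ∷ bs) =
    trans (indicator-adjacentʳ a b as bs) (sym (∑-δ (c a b) (λ γ → allOfColour γ as bs)))

  ∑∑-allOfColour : ∀ r γ →
    ∑[ as ∈ tuples n r ] ∑[ bs ∈ tuples n r ] allOfColour γ as bs ≡ colourClassSize γ ^ r
  ∑∑-allOfColour zero    γ = refl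
  ∑∑-allOfColour (suc r) γ = begin
      ∑[ as ∈ tuples n (suc r) ] ∑[ bs ∈ tuples n (suc r) ] allOfColour γ as bs
        ≡⟨ ∑∑-tuples-suc n r (allOfColour γ) ⟩
      ∑[ a ∈ F ] ∑[ b ∈ F ] ∑[ as ∈ T ] ∑[ bs ∈ T ] δ (c a b) γ * allOfColour γ as bs
        ≡⟨ ∑-cong F (λ a → ∑-cong F (λ b → sym (pull-out (δ (c a b) γ)))) ⟩
      ∑[ a ∈ F ] ∑[ b ∈ F ] δ (c a b) γ * (∑[ as ∈ T ] ∑[ bs ∈ T ] allOfColour γ as bs)
        ≡⟨ ∑-cong F (λ a → ∑-cong F (λ b → cong (δ (c a b) γ *_) (∑∑-allOfColour r γ))) ⟩
      ∑[ a ∈ F ] ∑[ b ∈ F ] δ (c a b) γ * colourClassSize γ ^ r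
        ≡⟨ sym (trans (*-distribʳ-∑ _ F _) (∑-cong F (λ a → *-distribʳ-∑ _ F _))) ⟩
      colourClassSize γ ^ suc r ∎
    where
      F = allFin n
      T = tuples n r
      open ≡-Reasoning
      pull-out : ∀ m → m * (∑[ as ∈ T ] ∑[ bs ∈ T ] allOfColour γ as bs) ≡
                       ∑[ as ∈ T ] ∑[ bs ∈ T ] m * allOfColour γ as bs
      pull-out m = trans (*-distribˡ-∑ m T _) (∑-cong T (λ as → *-distribˡ-∑ m T _))

  ∑-colourClassSize : ∑[ γ ∈ allFin k ] colourClassSize γ ≡ n * n
  ∑-colourClassSize = begin
      ∑[ γ ∈ allFin k ] ∑[ a ∈ F ] ∑[ b ∈ F ] δ (c a b) γ
        ≡⟨ sym (∑∑∑-comm F F (allFin k) (λ a b γ → δ (c a b) γ)) ⟩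
      ∑[ a ∈ F ] ∑[ b ∈ F ] ∑[ γ ∈ allFin k ] δ (c a b) γ
        ≡⟨ ∑-cong F (λ a → ∑-cong F (λ b → ∑-δ-one (c a b))) ⟩
      ∑[ a ∈ F ] ∑[ b ∈ F ] 1
        ≡⟨ trans (∑-cong F (λ a → ∑-const F 1)) (∑-const F _) ⟩
      length F * (length F * 1)
        ≡⟨ cong₂ _*_ (length-allFin n) (trans (*-identityʳ _) (length-allFin n)) ⟩
      n * n ∎
    where
      F = allFin n
      open ≡-Reasoning
      ∑-δ-one : ∀ x → ∑[ γ ∈ allFin k ] δ x γ ≡ 1
      ∑-δ-one x = trans (∑-cong (allFin k) (λ γ → sym (*-identityʳ (δ x γ)))) (∑-δ x (λ _ → 1))

  edgesʳ≡∑colourClassSize^ : ∀ r → edgesʳ (suc r) c ≡ ∑[ γ ∈ allFin k ] colourClassSize γ ^ suc r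
  edgesʳ≡∑colourClassSize^ r = begin
      edgesʳ (suc r) c
        ≡⟨ length-filter≡∑ (adjacentʳ? c) (cartesianProduct T T) ⟩
      ∑[ p ∈ cartesianProduct T T ] indicator (adjacentʳ? c p)
        ≡⟨ ∑-cartesianProduct T T _ ⟩
      ∑[ as ∈ T ] ∑[ bs ∈ T ] indicator (adjacentʳ? c (as , bs))
        ≡⟨ ∑-cong T (λ as → ∑-cong T (λ bs → indicator-adjacentʳ≡∑ as bs)) ⟩
      ∑[ as ∈ T ] ∑[ bs ∈ T ] ∑[ γ ∈ allFin k ] allOfColour γ as bs
        ≡⟨ ∑∑∑-comm T T (allFin k) (λ as bs γ → allOfColour γ as bs) ⟩
      ∑[ γ ∈ allFin k ] ∑[ as ∈ T ] ∑[ bs ∈ T ] allOfColour γ as bs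
        ≡⟨ ∑-cong (allFin k) (∑∑-allOfColour (suc r)) ⟩
      ∑[ γ ∈ allFin k ] colourClassSize γ ^ suc r ∎
    where
      T = tuples n (suc r)
      open ≡-Reasoning

proposition2p7 : (n k r : ℕ) → 2 ≤ r →
                 (c : Fin n → Fin n → Fin k) →
                 Surjective _≡_ _≡_ (λ (ab : Fin n × Fin n) → c (proj₁ ab) (proj₂ ab)) →
                 n ^ (2 * r) ≤ k ^ (r ∸ 1) * edgesʳ r c
proposition2p7 n k (suc r) (s≤s _) c _ = begin
    n ^ (2 * suc r)
      ≡⟨ sym (^-*-assoc n 2 (suc r)) ⟩
    (n * (n * 1)) ^ suc r
      ≡⟨ cong (λ m → (n * m) ^ suc r) (*-identityʳ n) ⟩
    (n * n) ^ suc r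
      ≡⟨ cong (_^ suc r) (sym ∑-colourClassSize) ⟩
    ∑ (allFin k) colourClassSize ^ suc r
      ≤⟨ power-mean (allFin k) colourClassSize r ⟩
    length (allFin k) ^ r * (∑[ γ ∈ allFin k ] colourClassSize γ ^ suc r)
      ≡⟨ cong₂ (λ m e → m ^ r * e) (length-allFin k) (sym (edgesʳ≡∑colourClassSize^ r)) ⟩
    k ^ r * edgesʳ (suc r) c ∎
  where
    open Colouring c
    open ≤-Reasoning
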